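{- Let $G=(V,E)$ be a graph, $c\ge1$, $\epsilon\in[0,1/3)$, let $\kappa(G)$ be an $(\epsilon,c)$-kernel of $G$ with tight nodes $\kappa_T(V)$, and let $M$ be a matching in $\kappa(G)$ such that every augmenting path in $\kappa(G)$ with respect to $M$ has length at least five. Let $F_T$ be the set of tight nodes unmatched in $M$. Then for every edge $(u,v)\in M$, $\big|(\kappa(\mathcal{N}_u)\cap F_T)\cup(\kappa(\mathcal{N}_v)\cap F_T)\big|\le(1+\epsilon)c$.
   Context: For $v\in V$ let $\mathcal{N}_v$ be its neighbors in $G$. A subgraph $\kappa(G)=(V,\kappa(E))$ with $\kappa(E)\subseteq E$, together with a partition of $V$ into tight nodes $\kappa_T(V)$ and slack nodes $\kappa_S(V)$, is an $(\epsilon,c)$-kernel of $G$ if, with $\kappa(\mathcal{N}_v)=\{u\in\mathcal{N}_v:(u,v)\in\kappa(E)\}$: (i) $|\kappa(\mathcal{N}_v)|\le(1+\epsilon)c$ for all $v\in V$; (ii) $|\kappa(\mathcal{N}_v)|\ge(1-\epsilon)c$ for all $v\in\kappa_T(V)$; (iii) every edge of $G$ joining two slack nodes lies in $\kappa(E)$. An augmenting path with respect to $M$ is a simple path whose endpoints are unmatched in $M$ and whose edges alternate between non-$M$ and $M$ edges; its length is its number of edges.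
   Formalization: The kernel parameters ε and c are taken to be rational numbers. -}

module Defs where

open import Data.Nat using (ℕ; zero; suc)
import Data.Nat as Nat
open import Data.Bool using (Bool; true; false; not; _∧_; _∨_; T)
open import Data.Fin using (Fin)
open import Data.List using (List; []; _∷_; length; filter; allFin)
open import Data.Bool.ListAction using (any)
open import Data.List.Relation.Unary.Unique.Propositional using (Unique)
open import Data.Integer using (+_)
open import Data.Rational using (ℚ; _/_; _≤_; _+_; _*_; _-_; 1ℚ)
open import Data.Product using (_×_; Σ; ∃)
open import Relation.Binary.PropositionalEquality using (_≡_)
open import Relation.Nullary using (¬_)
open import Relation.Unary using (Pred)
open import Relation.Nullary.Decidable using (Dec)
open import Data.Bool using (_≟_)

Rel₂ : ℕ → Set
Rel₂ n = Fin n → Fin n → Bool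

record SimpleGraph (n : ℕ) : Set where
  field
    adj   : Rel₂ n
    sym   : ∀ u v → adj u v ≡ adj v u
    irrefl : ∀ v → adj v v ≡ false

card : {n : ℕ} → (Fin n → Bool) → ℕ
card {n} P = length (filter (λ v → P v ≟ true) (allFin n))

ℕtoℚ : ℕ → ℚ
ℕtoℚ k = (+ k) / 1

_⊆E_ : {n : ℕ} → Rel₂ n → Rel₂ n → Set
_⊆E_ {n} K E = ∀ (u v : Fin n) → T (K u v) → T (E u v)

kNbr : {n : ℕ} → Rel₂ n → Fin n → (Fin n → Bool)
kNbr K v u = K u v

-- (ε,c)-kernel: kernel edge set K (symmetric, ⊆ E), tight predicate
-- (slack = not tight), conditions (i)-(iii).
record IsKernel {n : ℕ} (G : SimpleGraph n) (ε c : ℚ)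
                (K : Rel₂ n) (tight : Fin n → Bool) : Set where
  field
    sub   : K ⊆E SimpleGraph.adj G
    ksym  : ∀ u v → K u v ≡ K v u
    degUpper : ∀ v → ℕtoℚ (card (kNbr K v)) ≤ (1ℚ + ε) * c
    degLower : ∀ v → T (tight v) → (1ℚ - ε) * c ≤ ℕtoℚ (card (kNbr K v))
    slackEdges : ∀ u v → T (not (tight u)) → T (not (tight v)) →
                 T (SimpleGraph.adj G u v) → T (K u v)

record IsMatching {n : ℕ} (K : Rel₂ n) (M : Rel₂ n) : Set where
  field
    sub  : M ⊆E K
    msym : ∀ u v → M u v ≡ M v u
    atMostOne : ∀ v a b → T (M v a) → T (M v b) → a ≡ b

isFree : {n : ℕ} → Rel₂ n → Fin n → Bool
isFree {n} M v = not (any (M v) (allFin n))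

-- Walk in the graph with edge set K, given as vertex list, whose i-th edge
-- (i = 0,1,...) is a non-M edge for even i and an M edge for odd i.
-- AltFrom b: first edge must be in M iff b = true.
data Alt {n : ℕ} (K M : Rel₂ n) : Bool → List (Fin n) → Set where
  single : ∀ {b} v → Alt K M b (v ∷ [])
  step   : ∀ {b} u v {vs} → T (K u v) → M u v ≡ b →
           Alt K M (not b) (v ∷ vs) → Alt K M b (u ∷ v ∷ vs)

last' : {A : Set} → A → List A → A
last' d [] = d
last' d (x ∷ xs) = last' x xs

-- Augmenting path in the graph (Fin n, K) w.r.t. M, given by its vertex
-- sequence x ∷ xs (so it has length xs edges): a simple path (distinct
-- vertices) with at least one edge, whose edges alternate non-M / M
-- starting with a non-M edge, and whose two endpoints are unmatched.
record IsAugmentingPath {n : ℕ} (K M : Rel₂ n) (x : Fin n) (xs : List (Fin n)) : Set where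
  field
    hasEdge    : 1 Nat.≤ length xs
    simple     : Unique (x ∷ xs)
    alternates : Alt K M false (x ∷ xs)
    startFree  : T (isFree M x)
    endFree    : T (isFree M (last' x xs))

FT : {n : ℕ} → (Fin n → Bool) → Rel₂ n → Fin n → Bool
FT tight M w = tight w ∧ isFree M w

nbrFreeUnion : {n : ℕ} → Rel₂ n → (Fin n → Bool) → Rel₂ n → Fin n → Fin n → Fin n → Bool
nbrFreeUnion K tight M u v w =
  (kNbr K u w ∧ FT tight M w) ∨ (kNbr K v w ∧ FT tight M w)

module Submission where

open import Defs
open import Data.Nat using (ℕ; _≤_)
open import Data.Bool using (Bool; T)
open import Data.Fin using (Fin)
open import Data.List using (List; length)
open import Data.Integer using (+_)
open import Data.Rational using (ℚ; _/_; _+_; _*_; 0ℚ; 1ℚ) renaming (_≤_ to _≤ℚ_; _<_ to _<ℚ_)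

open import Data.Bool using (true; false; _∧_)
import Data.Bool as Bool
open import Data.Bool.Properties using (T-≡; T-∧; T-∨; T-not-≡; T?; ¬-not)
open import Data.Nat using (s≤s; z≤n)
open import Data.Fin using (_≟_)
open import Data.Fin.Properties using (any?)
open import Data.List using ([]; _∷_; allFin)
open import Data.List.Membership.Propositional.Properties using (∈-allFin)
open import Data.List.Relation.Binary.Sublist.Heterogeneous.Properties using (length-mono-≤)
open import Data.List.Relation.Binary.Sublist.Propositional using (⊆-refl)
open import Data.List.Relation.Binary.Sublist.Propositional.Properties using (filter⁺)
open import Data.List.Relation.Unary.All using ([]; _∷_)
open import Data.List.Relation.Unary.AllPairs using ([]; _∷_)
import Data.List.Relation.Unary.Any as Any
open import Data.List.Relation.Unary.Any.Properties using (any⁺)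
import Data.Integer as ℤ
open import Data.Integer.Properties using (*-identityʳ)
open import Data.Nat.Coprimality as Coprime using (1-coprimeTo)
import Data.Rational as ℚ
open import Data.Rational.Properties using (normalize-coprime; ≤-trans)
open import Data.Sum using (_⊎_; inj₁; inj₂; [_,_])
open import Data.Product using (_,_; proj₁; proj₂)
open import Function using (_∘_; Equivalence)
open Equivalence using (to; from)
open import Relation.Nullary using (¬_; yes; no; contradiction)
open import Relation.Binary.PropositionalEquality using (_≡_; _≢_; refl; subst; subst₂; sym; trans)

-- If u had a free tight kernel neighbour a and v had one b ≠ a, then a u v b
-- would be an augmenting path of length 3.  Hence either u has none, and the
-- union lies in κ(N_v), or every such neighbour of v is a, a kernel neighbour
-- of u, and the union lies in κ(N_u).  Either way the degree bound (i) at u or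
-- at v applies.

card-mono : ∀ {n} {P Q : Fin n → Bool} → (∀ x → T (P x) → T (Q x)) → card P ≤ card Q
card-mono {n} {P} {Q} P⇒Q = length-mono-≤
  (filter⁺ (λ x → P x Bool.≟ true) (λ x → Q x Bool.≟ true)
           (λ { refl Px → to T-≡ (P⇒Q _ (from T-≡ Px)) }) (⊆-refl {x = allFin n}))

ℕtoℚ-mono : ∀ {m k} → m ≤ k → ℕtoℚ m ≤ℚ ℕtoℚ k
ℕtoℚ-mono {m} {k} m≤k
  rewrite normalize-coprime (Coprime.sym (1-coprimeTo m))
        | normalize-coprime (Coprime.sym (1-coprimeTo k)) =
  ℚ.*≤* (subst₂ ℤ._≤_ (sym (*-identityʳ (+ m))) (sym (*-identityʳ (+ k))) (ℤ.+≤+ m≤k))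

free⇒unmatched : ∀ {n} (M : Rel₂ n) {x y} → T (isFree M x) → ¬ T (M x y)
free⇒unmatched M {x} {y} free-x Mxy =
  subst T (to T-not-≡ free-x) (any⁺ (M x) (Any.map (λ { refl → Mxy }) (∈-allFin y)))

module _ {n} {K M : Rel₂ n} (matching : IsMatching K M)
         {u v : Fin n} (u≢v : u ≢ v) (Muv : T (M u v)) where

  open IsMatching matching

  augmentingPath₃ : ∀ {a b} → a ≢ b → T (isFree M a) → T (K a u) →
                    T (isFree M b) → T (K v b) →
                    IsAugmentingPath K M a (u ∷ v ∷ b ∷ [])
  augmentingPath₃ {a} {b} a≢b free-a Kau free-b Kvb = record
    { hasEdge    = s≤s z≤n
    ; simple     = (a≢u ∷ a≢v ∷ a≢b ∷ []) ∷ (u≢v ∷ u≢b ∷ []) ∷ (v≢b ∷ []) ∷ [] ∷ []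
    ; alternates = step a u Kau (¬-not (free⇒unmatched M free-a ∘ from T-≡))
                     (step u v (sub u v Muv) (to T-≡ Muv)
                       (step v b Kvb Mvb≡false (single b)))
    ; startFree  = free-a
    ; endFree    = free-b
    }
    where
    Mvu : T (M v u)
    Mvu = subst T (msym u v) Muv
    Mvb≡false : M v b ≡ false
    Mvb≡false = trans (msym v b) (¬-not (free⇒unmatched M free-b ∘ from T-≡))
    a≢u : a ≢ u
    a≢u refl = free⇒unmatched M free-a Muv
    a≢v : a ≢ v
    a≢v refl = free⇒unmatched M free-a Mvu
    u≢b : u ≢ b
    u≢b refl = free⇒unmatched M free-b Muv
    v≢b : v ≢ b
    v≢b refl = free⇒unmatched M free-b Mvu

  module _ (longAugmenting : ∀ x xs → IsAugmentingPath K M x xs → 5 ≤ length xs) where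

    free-nbrs-coincide : ∀ {a b} → T (isFree M a) → T (K a u) →
                         T (isFree M b) → T (K v b) → a ≡ b
    free-nbrs-coincide {a} {b} free-a Kau free-b Kvb with a ≟ b
    ... | yes a≡b = a≡b
    ... | no  a≢b = contradiction
      (longAugmenting _ _ (augmentingPath₃ a≢b free-a Kau free-b Kvb))
      λ { (s≤s (s≤s (s≤s ()))) }

    module _ (ksym : ∀ x y → K x y ≡ K y x) (tight : Fin n → Bool) where

      freeTightNbr : Fin n → Fin n → Bool
      freeTightNbr x w = kNbr K x w ∧ FT tight M w

      freeTightNbr⇒nbr : ∀ {x w} → T (freeTightNbr x w) → T (kNbr K x w)
      freeTightNbr⇒nbr {x} {w} = proj₁ ∘ to (T-∧ {K w x})

      freeTightNbr⇒free : ∀ {x w} → T (freeTightNbr x w) → T (isFree M w)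
      freeTightNbr⇒free {x} {w} = proj₂ ∘ to (T-∧ {tight w}) ∘ proj₂ ∘ to (T-∧ {K w x})

      nbrFreeUnion⊆kNbr :
        (∀ w → T (nbrFreeUnion K tight M u v w) → T (kNbr K u w)) ⊎
        (∀ w → T (nbrFreeUnion K tight M u v w) → T (kNbr K v w))
      nbrFreeUnion⊆kNbr with any? (λ a → T? (freeTightNbr u a))
      ... | no ∄a =
        inj₂ λ w → [ (λ a → contradiction (w , a) ∄a) , freeTightNbr⇒nbr ] ∘ to T-∨
      ... | yes (a , a∈Nu) =
        inj₁ λ w → [ freeTightNbr⇒nbr , (λ b → subst (T ∘ kNbr K u) (a≡ b) a-u) ] ∘ to T-∨
        where
        a-u : T (K a u)
        a-u = freeTightNbr⇒nbr a∈Nu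
        a≡ : ∀ {b} → T (freeTightNbr v b) → a ≡ b
        a≡ {b} b∈Nv = free-nbrs-coincide (freeTightNbr⇒free a∈Nu) a-u
                        (freeTightNbr⇒free b∈Nv) (subst T (ksym b v) (freeTightNbr⇒nbr b∈Nv))

lemma3p13 : (n : ℕ) (G : SimpleGraph n) (ε c : ℚ) →
    1ℚ ≤ℚ c → 0ℚ ≤ℚ ε → ε <ℚ ((+ 1) / 3) →
    (K : Rel₂ n) (tight : Fin n → Bool) → IsKernel G ε c K tight →
    (M : Rel₂ n) → IsMatching K M →
    (∀ (x : Fin n) (xs : List (Fin n)) → IsAugmentingPath K M x xs → 5 ≤ length xs) →
    ∀ (u v : Fin n) → T (M u v) →
    ℕtoℚ (card (nbrFreeUnion K tight M u v)) ≤ℚ (1ℚ + ε) * c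
lemma3p13 n G ε c _ _ _ K tight kernel M matching longAugmenting u v Muv =
  [ degreeBound u , degreeBound v ]
    (nbrFreeUnion⊆kNbr matching u≢v Muv longAugmenting ksym tight)
  where
  open IsKernel kernel
  degreeBound : ∀ x → (∀ w → T (nbrFreeUnion K tight M u v w) → T (kNbr K x w)) →
                ℕtoℚ (card (nbrFreeUnion K tight M u v)) ≤ℚ (1ℚ + ε) * c
  degreeBound x ⊆kNbr = ≤-trans (ℕtoℚ-mono (card-mono ⊆kNbr)) (degUpper x)
  u≢v : u ≢ v
  u≢v refl = subst T (SimpleGraph.irrefl G u) (sub u u (IsMatching.sub matching u u Muv))
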